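{- For every integer $n\ge 3$, the nim-number of $\mathsf{GEN}(\mathbb{D}_n)$ is $3$ if $n$ is odd, $0$ if $n\equiv 0\pmod 4$, and $1$ if $n\equiv 2\pmod 4$.
   Context: $\mathbb{D}_n=\langle r,f\mid r^n=f^2=e,\ rf=fr^{n-1}\rangle$ is the dihedral group of order $2n$. For a finite group $G$, the achievement game $\mathsf{GEN}(G)$ is the impartial game (normal play) with starting position $\emptyset$, positions $\emptyset$, the subsets $P\subseteq G$ with $\langle P\rangle\neq G$, and the subsets $P$ with $\langle P\rangle=G$ such that $\langle P\setminus\{s\}\rangle\neq G$ for some $s\in P$; a non-generating $P$ has options $\{P\cup\{g\}:g\in G\setminus P\}$ and a generating $P$ has none. $\operatorname{nim}(P)=\operatorname{mex}\{\operatorname{nim}(Q):Q\in\operatorname{Opt}(P)\}$ ($\operatorname{mex}$ = least nonnegative integer not in the set); the nim-number of the game is $\operatorname{nim}(\emptyset)$. -}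

module Defs where

open import Data.Nat using (ℕ; zero; suc; _+_; _∸_; NonZero)
open import Data.Nat.DivMod using (_mod_)
open import Data.Nat.Properties using () renaming (_≟_ to _≟ℕ_)
open import Data.Fin using (Fin; toℕ; zero; suc) renaming (_≟_ to _≟F_)
open import Data.Bool using (Bool; true; false; not; if_then_else_)
open import Data.Bool.Properties using () renaming (_≟_ to _≟B_)
open import Data.Product using (_×_; _,_)
open import Data.Product.Properties using (≡-dec)
open import Data.List using (List; []; _∷_; length; map; filterᵇ; allFin; cartesianProduct)
open import Relation.Nullary using (Dec; yes; no; does)
open import Relation.Binary.PropositionalEquality using (_≡_)

-- The dihedral group D_n of order 2n (n ≥ 1), concrete model:
-- the pair (k , b) stands for r^k f^b  (k ∈ ℤ/n, b ∈ {0,1}).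
-- r = (1 , false), f = (0 , true); relations r^n = f^2 = e, rf = f r^(n-1).

D : ℕ → Set
D n = Fin n × Bool

module _ (n : ℕ) .{{_ : NonZero n}} where

  _⊕_ : Fin n → Fin n → Fin n
  k ⊕ l = (toℕ k + toℕ l) mod n

  ⊖_ : Fin n → Fin n
  ⊖ l = (n ∸ toℕ l) mod n

  e : D n
  e = (0 mod n , false)

  r : D n
  r = (1 mod n , false)

  f : D n
  f = (0 mod n , true)

  -- r^k f^b · r^l f^c :  f r^l = r^(-l) f
  _·_ : D n → D n → D n
  (k , false) · (l , c) = (k ⊕ l , c)
  (k , true)  · (l , c) = (k ⊕ (⊖ l) , not c)

  _⁻¹ : D n → D n
  (k , false) ⁻¹ = (⊖ k , false)
  (k , true)  ⁻¹ = (k , true)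

  elems : List (D n)
  elems = cartesianProduct (allFin n) (false ∷ true ∷ [])

  _≟D_ : (x y : D n) → Dec (x ≡ y)
  _≟D_ = ≡-dec _≟F_ _≟B_

  SubsetD : Set
  SubsetD = D n → Bool

  ∅ : SubsetD
  ∅ _ = false

  insert : D n → SubsetD → SubsetD
  insert g P x = if does (x ≟D g) then true else P x

  data _∈⟨_⟩ : D n → SubsetD → Set where
    base : ∀ {P g} → P g ≡ true → g ∈⟨ P ⟩
    unit : ∀ {P} → e ∈⟨ P ⟩
    mul  : ∀ {P g h} → g ∈⟨ P ⟩ → h ∈⟨ P ⟩ → (g · h) ∈⟨ P ⟩
    inv  : ∀ {P g} → g ∈⟨ P ⟩ → (g ⁻¹) ∈⟨ P ⟩

  Generates : SubsetD → Set
  Generates P = ∀ g → g ∈⟨ P ⟩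

-- mex of a finite list of naturals: least m ∉ xs (it is ≤ length xs).

_∈ᵇ_ : ℕ → List ℕ → Bool
m ∈ᵇ [] = false
m ∈ᵇ (x ∷ xs) = if does (m ≟ℕ x) then true else m ∈ᵇ xs

mex : List ℕ → ℕ
mex xs = search (suc (length xs)) 0
  where
  search : ℕ → ℕ → ℕ
  search zero m = m
  search (suc k) m = if m ∈ᵇ xs then search k (suc m) else m

-- The nim-value computation is parameterised
-- by a decision procedure for "P generates D_n" (any two such deciders
-- agree, since Generates P is a proposition-valued predicate's yes/no).
-- nimF k P : nim-number of position P, with fuel k ≥ |D_n \ P|.
-- A generating position has no options, so its nim-number is mex ∅ = 0.

module _ (n : ℕ) .{{_ : NonZero n}}
         (gen? : (P : SubsetD n) → Dec (Generates n P)) where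

  nimF : ℕ → SubsetD n → ℕ
  nimF zero P = 0   -- unreachable with enough fuel (P would be all of D_n)
  nimF (suc k) P with gen? P
  ... | yes _ = 0
  ... | no  _ = mex (map (λ g → nimF k (insert n g P))
                         (filterᵇ (λ g → not (P g)) (elems n)))

  -- nim(GEN(D_n)) = nim(∅); fuel 2n = |D_n| suffices.
  nimGEN : ℕ
  nimGEN = nimF (n + n) (∅ n)

-- Write k for the number of elements missing from a position; this is the fuel
-- with which nimF evaluates it.  A non-generating position containing a reflection s has
-- nim-value 1 or 2 as k is even or odd: adding r generates, and when k is odd some move keeps the
-- position non-generating, since otherwise the position would be closed under x ↦ x s, which
-- pairs off the missing elements.  A position of rotations generating ⟨r^d⟩ (d ∣ n) has a
-- nim-value depending only on the class of d and on the parity of k: adding a reflection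
-- generates iff d = 1, and adding r^l gives ⟨r^gcd(l,d)⟩.  The parity of k for the full subgroup
-- ⟨r^d⟩ follows by pairing each rotation with its inverse.  Evaluating at ∅, which generates
-- ⟨r^n⟩ and misses 2n elements, gives 3, 0 or 1 according to n mod 4.

module Submission where

open import Defs
open import Data.Bool using (Bool; true; false; not; if_then_else_; T)
open import Data.Bool.Properties using (not-involutive; not-injective) renaming (_≟_ to _≟B_)
open import Data.Fin using (Fin; toℕ)
open import Data.Fin.Properties using (toℕ-injective; toℕ<n; toℕ≤n; toℕ-fromℕ<; pigeonhole) renaming (any? to anyFin?)
open import Data.List using (List; []; _∷_; length; lookup; map; filterᵇ; allFin; cartesianProduct)
open import Data.List.Properties using (length-tabulate)
open import Data.List.Membership.Propositional using (_∈_; _∉_; lose)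
open import Data.List.Membership.Propositional.Properties
  using (∈-cartesianProduct⁺; ∈-allFin; ∈-map⁺; ∈-map⁻; ∈-filter⁺; ∈-filter⁻)
open import Data.List.Relation.Unary.All using ([]; _∷_)
open import Data.List.Relation.Unary.All.Properties using (All¬⇒¬Any)
open import Data.List.Relation.Unary.AllPairs using ([]; _∷_)
open import Data.List.Relation.Unary.Any using (here; there; index; any?; satisfied)
open import Data.List.Relation.Unary.Any.Properties using (lookup-index)
open import Data.List.Relation.Unary.Unique.Propositional using (Unique)
open import Data.List.Relation.Unary.Unique.Propositional.Properties using (cartesianProduct⁺; allFin⁺)
open import Data.Nat
  using (ℕ; zero; suc; _+_; _*_; _∸_; _%_; ⌊_/2⌋; _<_; _≤_; _≤?_; _≡ᵇ_; z≤n; z<s; s≤s;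
         NonZero; ≢-nonZero; ≢-nonZero⁻¹; >-nonZero)
open import Data.Nat.Properties
  using (≤-refl; <⇒≤; ≰⇒>; <⇒≱; <-irrefl; <-≤-trans; ≡ᵇ⇒≡; ≡⇒≡ᵇ; suc-injective;
         +-assoc; +-comm; +-suc; +-identityʳ; *-comm; *-identityʳ; *-distribˡ-+;
         m+[n∸m]≡n; m∸n+n≡m; m∸[m∸n]≡n; m+n∸n≡m; ∸-monoʳ-<; m<m+n; n≢0⇒n>0; n≡⌊n+n/2⌋)
  renaming (_≟_ to _≟ℕ_)
open import Data.Nat.DivMod
  using (_mod_; _/_; m≡m%n+[m/n]*n; m%n<n; m%n≤n; m%n%n≡m%n; n%n≡0; %-distribˡ-+;
         [m+n]%n≡m%n; m<n⇒m%n≡m; m*n%n≡0; m∣n⇒o%n%m≡o%m)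
open import Data.Nat.Divisibility
  using (_∣_; _∣?_; divides; 1∣_; _∣0; ∣-refl; ∣-trans; ∣-antisym; ∣⇒≤; ∣1⇒≡1; 0∣⇒≡0;
         m%n≡0⇒n∣m; n∣m⇒m%n≡0)
open import Data.Nat.Coprimality using (Coprime; coprime-divisor; gcd≡1⇒coprime)
open import Data.Nat.GCD
  using (gcd; gcd-GCD; module Bézout; gcd[m,n]∣m; gcd[m,n]∣n; gcd-greatest; gcd-comm; gcd-zeroˡ)
open import Data.Product using (_×_; _,_; ∃; proj₁; proj₂)
open import Data.Sum using (_⊎_; inj₁; inj₂; [_,_]′)
open import Data.Unit using (tt)
open import Function using (_∘_; id; case_of_)
open import Relation.Binary.Definitions using (DecidableEquality)
open import Relation.Binary.PropositionalEquality
open import Relation.Nullary using (¬_; Dec; yes; no; does; contradiction)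
open import Relation.Nullary.Decidable using (T?; ¬?; _×-dec_)

∈ᵇ⇒∈ : ∀ {m} xs → m ∈ᵇ xs ≡ true → m ∈ xs
∈ᵇ⇒∈ {m} (x ∷ xs) h with m ≡ᵇ x | ≡ᵇ⇒≡ m x
... | true  | m≡x = here (m≡x _)
... | false | _   = there (∈ᵇ⇒∈ xs h)

∈⇒∈ᵇ : ∀ {m xs} → m ∈ xs → m ∈ᵇ xs ≡ true
∈⇒∈ᵇ {m} {x ∷ _} (here refl) with m ≡ᵇ m | ≡⇒≡ᵇ m m refl
... | true | _ = refl
∈⇒∈ᵇ {m} {x ∷ _} (there m∈xs) with m ≡ᵇ x
... | true  = refl
... | false = ∈⇒∈ᵇ m∈xs

∉⇒∉ᵇ : ∀ {m} xs → m ∉ xs → m ∈ᵇ xs ≡ false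
∉⇒∉ᵇ {m} xs m∉xs with m ∈ᵇ xs in eq
... | true = contradiction (∈ᵇ⇒∈ xs eq) m∉xs
... | false = refl

⊆⇒length≥ : ∀ {v xs} → (∀ j → j < v → j ∈ xs) → v ≤ length xs
⊆⇒length≥ {v} {xs} below with v ≤? length xs
... | yes v≤len = v≤len
... | no v≰len =
  let i , j , i<j , same = pigeonhole (≰⇒> v≰len) (λ i → index (below (toℕ i) (toℕ<n i)))
  in contradiction (trans (lookup-index (below (toℕ i) (toℕ<n i)))
                     (trans (cong (lookup xs) same) (sym (lookup-index (below (toℕ j) (toℕ<n j))))))
                   (λ eq → <-irrefl eq i<j)

-- Defs.mex runs a local search loop, which can only be unfolded a fixed number of times.
mex-≡ : ∀ {xs} v → v ≤ 3 → (∀ j → j < v → j ∈ xs) → v ∉ xs → mex xs ≡ v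
mex-≡ {xs} v _ below v∉xs with length xs | ⊆⇒length≥ below | ∉⇒∉ᵇ xs v∉xs
mex-≡ 0 _ _ _ | _ | _ | v∉ᵇ rewrite v∉ᵇ = refl
mex-≡ 1 _ below _ | suc _ | _ | v∉ᵇ
  rewrite ∈⇒∈ᵇ (below 0 (s≤s z≤n)) | v∉ᵇ = refl
mex-≡ 2 _ below _ | suc (suc _) | _ | v∉ᵇ
  rewrite ∈⇒∈ᵇ (below 0 (s≤s z≤n)) | ∈⇒∈ᵇ (below 1 (s≤s (s≤s z≤n))) | v∉ᵇ = refl
mex-≡ 3 _ below _ | suc (suc (suc _)) | _ | v∉ᵇ
  rewrite ∈⇒∈ᵇ (below 0 (s≤s z≤n)) | ∈⇒∈ᵇ (below 1 (s≤s (s≤s z≤n)))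
        | ∈⇒∈ᵇ (below 2 (s≤s (s≤s (s≤s z≤n)))) | v∉ᵇ = refl
mex-≡ 2 _ _ _ | 1 | s≤s () | _
mex-≡ 3 _ _ _ | 1 | s≤s () | _
mex-≡ 3 _ _ _ | 2 | s≤s (s≤s ()) | _
mex-≡ (suc (suc (suc (suc _)))) (s≤s (s≤s (s≤s ()))) _ _ | _ | _ | _

∈-∉ᵇ⇒≢ : ∀ {x v xs} → x ∈ xs → v ∈ᵇ xs ≡ false → x ≢ v
∈-∉ᵇ⇒≢ x∈xs v∉xs refl = case trans (sym (∈⇒∈ᵇ x∈xs)) v∉xs of λ ()

T-not⇒≡false : ∀ {b} → T (not b) → b ≡ false
T-not⇒≡false {false} _ = refl

even : ℕ → Bool
even zero    = true
even (suc n) = not (even n)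

even-+ : ∀ a b → even (a + b) ≡ (if even a then even b else not (even b))
even-+ zero    b = refl
even-+ (suc a) b rewrite even-+ a b with even a
... | true  = refl
... | false = not-involutive (even b)

even-double : ∀ m → even (m + m) ≡ true
even-double m rewrite even-+ m m with even m
... | true  = refl
... | false = refl

even-+-true : ∀ a b → even (a + b) ≡ true → even a ≡ even b
even-+-true a b h with even a | even b | trans (sym (even-+ a b)) h
... | true  | true  | _  = refl
... | true  | false | ()
... | false | true  | ()
... | false | false | _  = refl

+-double-injective : ∀ {a b} → a + a ≡ b + b → a ≡ b
+-double-injective {a} {b} eq = trans (n≡⌊n+n/2⌋ a) (trans (cong ⌊_/2⌋ eq) (sym (n≡⌊n+n/2⌋ b)))

≡ᵇ-true : ∀ {m n} → (m ≡ᵇ n) ≡ true → m ≡ n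
≡ᵇ-true {m} {n} h = ≡ᵇ⇒≡ m n (subst T (sym h) tt)

≡ᵇ-false : ∀ {m n} → (m ≡ᵇ n) ≡ false → m ≢ n
≡ᵇ-false {m} h refl with m ≡ᵇ m | ≡⇒≡ᵇ m m refl
≡ᵇ-false {m} () refl | true | _

≢⇒≡ᵇ-false : ∀ {m n} → m ≢ n → (m ≡ᵇ n) ≡ false
≢⇒≡ᵇ-false {m} {n} m≢n with m ≡ᵇ n | ≡ᵇ⇒≡ m n
... | true  | m≡n = contradiction (m≡n _) m≢n
... | false | _   = refl

even⇒half : ∀ x → even x ≡ true → ∃ λ h → x ≡ h + h
even⇒half zero          _  = 0 , refl
even⇒half (suc (suc x)) ex with even⇒half x (trans (sym (not-involutive (even x))) ex)
... | h , refl = suc h , cong suc (sym (+-suc h h))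

m*2≡m+m : ∀ h → h * 2 ≡ h + h
m*2≡m+m h = trans (*-comm h 2) (cong (h +_) (+-identityʳ h))

2∣⇒even : ∀ {x} → 2 ∣ x → even x ≡ true
2∣⇒even (divides h refl) = subst (λ y → even y ≡ true) (sym (m*2≡m+m h)) (even-double h)

even⇒2∣ : ∀ {x} → even x ≡ true → 2 ∣ x
even⇒2∣ {x} ex with even⇒half x ex
... | h , refl = divides h (sym (m*2≡m+m h))

∣2⇒≡1⊎≡2 : ∀ {x} → x ∣ 2 → x ≡ 1 ⊎ x ≡ 2
∣2⇒≡1⊎≡2 {0}                 0∣2 = case 0∣⇒≡0 0∣2 of λ ()
∣2⇒≡1⊎≡2 {1}                 _   = inj₁ refl
∣2⇒≡1⊎≡2 {2}                 _   = inj₂ refl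
∣2⇒≡1⊎≡2 {suc (suc (suc _))} x∣2 = case ∣⇒≤ x∣2 of λ { (s≤s (s≤s ())) }

odd-∣-double : ∀ {d m} → even d ≡ false → d ∣ m + m → d ∣ m
odd-∣-double {d} {m} d-odd d∣2m = coprime-divisor coprime-to-2 (subst (d ∣_) (cong (m +_) (sym (+-identityʳ m))) d∣2m)
  where
  coprime-to-2 : Coprime d 2
  coprime-to-2 (c∣d , c∣2) with ∣2⇒≡1⊎≡2 c∣2
  ... | inj₁ c≡1 = c≡1
  ... | inj₂ refl = case trans (sym d-odd) (2∣⇒even c∣d) of λ ()

double-∣-double : ∀ {h m} → h + h ∣ m + m → h ∣ m
double-∣-double {h} {m} (divides q eq) = divides q (+-double-injective (trans eq (*-distribˡ-+ q h h)))

1<d : ∀ {d} → d ≢ 0 → d ≢ 1 → 1 < d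
1<d {0}           d≢0 _   = contradiction refl d≢0
1<d {1}           _   d≢1 = contradiction refl d≢1
1<d {suc (suc _)} _   _   = s≤s (s≤s z≤n)

2<d : ∀ {d} → d ≢ 0 → d ≢ 1 → d ≢ 2 → 2 < d
2<d {0}                 d≢0 _   _   = contradiction refl d≢0
2<d {1}                 _   d≢1 _   = contradiction refl d≢1
2<d {2}                 _   _   d≢2 = contradiction refl d≢2
2<d {suc (suc (suc _))} _   _   _   = s≤s (s≤s (s≤s z≤n))

odd⇒¬2∣ : ∀ {x} → even x ≡ false → ¬ 2 ∣ x
odd⇒¬2∣ x-odd 2∣x = case trans (sym x-odd) (2∣⇒even 2∣x) of λ ()

module Counting {A : Set} (_≟_ : DecidableEquality A) where

  count : (A → Bool) → List A → ℕ
  count q ys = length (filterᵇ q ys)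

  infixl 5 _without_
  _without_ : (A → Bool) → A → A → Bool
  (q without x) y = if does (y ≟ x) then false else q y

  without-≡ : ∀ q x → (q without x) x ≡ false
  without-≡ q x with x ≟ x
  ... | yes _   = refl
  ... | no x≢x = contradiction refl x≢x

  without-≢ : ∀ q {x y} → y ≢ x → (q without x) y ≡ q y
  without-≢ q {x} {y} y≢x with y ≟ x
  ... | yes y≡x = contradiction y≡x y≢x
  ... | no _    = refl

  without-true : ∀ q {x y} → (q without x) y ≡ true → q y ≡ true × y ≢ x
  without-true q {x} {y} h with y ≟ x
  without-true q {x} {y} () | yes _
  ... | no y≢x = h , y≢x

  count-∷ : ∀ q y ys → count q (y ∷ ys) ≡ (if q y then suc else id) (count q ys)
  count-∷ q y ys with q y
  ... | true  = refl
  ... | false = refl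

  count-cong : ∀ {q q′} ys → (∀ {y} → y ∈ ys → q y ≡ q′ y) → count q ys ≡ count q′ ys
  count-cong []       _    = refl
  count-cong {q} {q′} (y ∷ ys) q≗q′ = begin
    count q (y ∷ ys)                          ≡⟨ count-∷ q y ys ⟩
    (if q y then suc else id) (count q ys)    ≡⟨ cong₂ (λ b → if b then suc else id) (q≗q′ (here refl))
                                                       (count-cong ys (q≗q′ ∘ there)) ⟩
    (if q′ y then suc else id) (count q′ ys)  ≡⟨ count-∷ q′ y ys ⟨
    count q′ (y ∷ ys)                         ∎
    where open ≡-Reasoning

  count-without : ∀ {q x} ys → Unique ys → x ∈ ys → q x ≡ true → count q ys ≡ suc (count (q without x) ys)
  count-without {q} {x} (x ∷ ys) (x-fresh ∷ _) (here refl) qx = begin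
    count q (x ∷ ys)                            ≡⟨ count-∷ q x ys ⟩
    (if q x then suc else id) (count q ys)      ≡⟨ cong (λ b → (if b then suc else id) (count q ys)) qx ⟩
    suc (count q ys)                            ≡⟨ cong suc (count-cong ys λ y∈ys →
                                                     without-≢ q λ { refl → All¬⇒¬Any x-fresh y∈ys }) ⟨
    suc (count q′ ys)                           ≡⟨ cong (λ b → suc ((if b then suc else id) (count q′ ys))) (without-≡ q x) ⟨
    suc ((if q′ x then suc else id) (count q′ ys)) ≡⟨ cong suc (count-∷ q′ x ys) ⟨
    suc (count q′ (x ∷ ys))                     ∎
    where
    open ≡-Reasoning
    q′ = q without x
  count-without {q} {x} (y ∷ ys) (y-fresh ∷ ys-unique) (there x∈ys) qx = begin
    count q (y ∷ ys)                          ≡⟨ count-∷ q y ys ⟩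
    (if q y then suc else id) (count q ys)    ≡⟨ cong (if q y then suc else id) (count-without ys ys-unique x∈ys qx) ⟩
    (if q y then suc else id) (suc c)         ≡⟨ suc-comm (q y) ⟩
    suc ((if q y then suc else id) c)         ≡⟨ cong (λ b → suc ((if b then suc else id) c)) (without-≢ q y≢x) ⟨
    suc ((if q′ y then suc else id) c)        ≡⟨ cong suc (count-∷ q′ y ys) ⟨
    suc (count q′ (y ∷ ys))                   ∎
    where
    open ≡-Reasoning
    q′ = q without x
    c = count q′ ys
    y≢x : y ≢ x
    y≢x refl = All¬⇒¬Any y-fresh x∈ys
    suc-comm : ∀ b → (if b then suc else id) (suc c) ≡ suc ((if b then suc else id) c)
    suc-comm true  = refl
    suc-comm false = refl

  count-suc⇒∃ : ∀ q ys {m} → count q ys ≡ suc m → ∃ λ x → q x ≡ true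
  count-suc⇒∃ q (y ∷ ys) h with q y in qy
  ... | true  = y , qy
  ... | false = count-suc⇒∃ q ys h

  count-zero⇒false : ∀ q {ys} → count q ys ≡ 0 → ∀ {x} → x ∈ ys → q x ≡ false
  count-zero⇒false q {y ∷ ys} h x∈ with q y in qy
  count-zero⇒false q {y ∷ ys} h (here refl)  | false = qy
  count-zero⇒false q {y ∷ ys} h (there x∈ys) | false = count-zero⇒false q h x∈ys

  count-true : ∀ ys → count (λ _ → true) ys ≡ length ys
  count-true []       = refl
  count-true (_ ∷ ys) = cong suc (count-true ys)

  count-+-count-not : ∀ q ys → count q ys + count (not ∘ q) ys ≡ length ys
  count-+-count-not q [] = refl
  count-+-count-not q (y ∷ ys) with q y
  ... | true  = cong suc (count-+-count-not q ys)
  ... | false = trans (+-suc (count q ys) _) (cong suc (count-+-count-not q ys))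

  module Involution (xs : List A) (xs-unique : Unique xs) (xs-complete : ∀ x → x ∈ xs)
                    (ι : A → A) (ι-involutive : ∀ x → ι (ι x) ≡ x) where

    Closed : (A → Bool) → Set
    Closed q = ∀ {x} → q x ≡ true → q (ι x) ≡ true

    FixedPointFree : (A → Bool) → Set
    FixedPointFree q = ∀ {x} → q x ≡ true → ι x ≢ x

    ι-injective : ∀ {x y} → ι x ≡ ι y → x ≡ y
    ι-injective {x} {y} ιx≡ιy = trans (sym (ι-involutive x)) (trans (cong ι ιx≡ιy) (ι-involutive y))

    without-fixed-closed : ∀ {q z} → ι z ≡ z → Closed q → Closed (q without z)
    without-fixed-closed {q} {z} ιz≡z q-closed {y} h with without-true q h
    ... | qy , y≢z = trans (without-≢ q (λ ιy≡z → y≢z (ι-injective (trans ιy≡z (sym ιz≡z))))) (q-closed qy)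

    private
      remove-pair : ∀ {q x} → q x ≡ true → Closed q → FixedPointFree q →
                    let q″ = q without x without ι x in
                    count q xs ≡ suc (suc (count q″ xs)) × Closed q″ × FixedPointFree q″
      remove-pair {q} {x} qx q-closed q-free = #q , q″-closed , q″-free
        where
        q′ = q without x
        q″ = q′ without ι x
        #q : count q xs ≡ suc (suc (count q″ xs))
        #q = trans (count-without xs xs-unique (xs-complete x) qx)
                   (cong suc (count-without xs xs-unique (xs-complete (ι x))
                                (trans (without-≢ q (q-free qx)) (q-closed qx))))
        q″-closed : Closed q″
        q″-closed {y} q″y with without-true q′ q″y
        ... | q′y , y≢ιx with without-true q q′y
        ... | qy , y≢x = trans (without-≢ q′ (y≢x ∘ ι-injective))
                               (trans (without-≢ q (λ ιy≡x → y≢ιx (trans (sym (ι-involutive y)) (cong ι ιy≡x))))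
                                      (q-closed qy))
        q″-free : FixedPointFree q″
        q″-free q″y = q-free (proj₁ (without-true q (proj₁ (without-true q′ q″y))))

    even-count : ∀ q → Closed q → FixedPointFree q → even (count q xs) ≡ true
    even-count q = go (count q xs) q refl
      where
      go : ∀ m q → count q xs ≡ m → Closed q → FixedPointFree q → even m ≡ true
      go zero _ _ _ _ = refl
      go (suc m) q #q q-closed q-free with count-suc⇒∃ q xs #q
      ... | x , qx with remove-pair qx q-closed q-free
      ... | #q≡ , q″-closed , q″-free with trans (sym #q) #q≡
      go (suc (suc m)) q #q q-closed q-free | x , qx | #q≡ , q″-closed , q″-free | m≡ =
        trans (not-involutive (even m)) (go m _ (sym (suc-injective (suc-injective m≡))) q″-closed q″-free)

-- The dihedral group

%-cong-+ : ∀ m .{{_ : NonZero m}} {a a′ b b′} →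
           a % m ≡ a′ % m → b % m ≡ b′ % m → (a + b) % m ≡ (a′ + b′) % m
%-cong-+ m {a} {a′} {b} {b′} a≡a′ b≡b′ = begin
  (a + b) % m            ≡⟨ %-distribˡ-+ a b m ⟩
  (a % m + b % m) % m    ≡⟨ cong₂ (λ x y → (x + y) % m) a≡a′ b≡b′ ⟩
  (a′ % m + b′ % m) % m  ≡⟨ %-distribˡ-+ a′ b′ m ⟨
  (a′ + b′) % m          ∎
  where open ≡-Reasoning

+-%-zeroˡ : ∀ m .{{_ : NonZero m}} {a b} → a % m ≡ 0 → (a + b) % m ≡ b % m
+-%-zeroˡ m {a} {b} a≡0 = %-cong-+ m {a} {0} (trans a≡0 (sym (m*n%n≡0 0 m))) refl

+-%-zeroʳ : ∀ m .{{_ : NonZero m}} {a b} → b % m ≡ 0 → (a + b) % m ≡ a % m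
+-%-zeroʳ m {a} {b} b≡0 = trans (cong (_% m) (+-comm a b)) (+-%-zeroˡ m b≡0)

module Dihedral (n : ℕ) {{_ : NonZero n}} where

  infixl 7 _∙_
  _∙_ : D n → D n → D n
  _∙_ = _·_ n

  infix 8 _⁻
  _⁻ : D n → D n
  _⁻ = _⁻¹ n

  infix 4 _∈⟪_⟫
  _∈⟪_⟫ : D n → SubsetD n → Set
  _∈⟪_⟫ = _∈⟨_⟩ n

  toℕ-mod : ∀ m → toℕ (m mod n) ≡ m % n
  toℕ-mod m = toℕ-fromℕ< (m%n<n m n)

  mod-≡ : ∀ {a b} → a % n ≡ b % n → a mod n ≡ b mod n
  mod-≡ a≡b = toℕ-injective (trans (toℕ-mod _) (trans a≡b (sym (toℕ-mod _))))

  toℕ-mod-% : ∀ a → toℕ (a mod n) % n ≡ a % n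
  toℕ-mod-% a = trans (cong (_% n) (toℕ-mod a)) (m%n%n≡m%n a n)

  toℕ-mod-toℕ : ∀ l → toℕ l mod n ≡ l
  toℕ-mod-toℕ l = toℕ-injective (trans (toℕ-mod _) (m<n⇒m%n≡m (toℕ<n l)))

  rot : ℕ → D n
  rot m = (m mod n , false)

  rot-toℕ : ∀ l → rot (toℕ l) ≡ (l , false)
  rot-toℕ l = cong (_, false) (toℕ-mod-toℕ l)

  rot-+ : ∀ a b → rot a ∙ rot b ≡ rot (a + b)
  rot-+ a b = cong (_, false) (mod-≡ (%-cong-+ n (toℕ-mod-% a) (toℕ-mod-% b)))

  rot-⁻ : ∀ b → rot b ⁻ ≡ rot (n ∸ b % n)
  rot-⁻ b = cong (λ z → rot (n ∸ z)) (toℕ-mod b)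

  module _ (d : ℕ) .{{_ : NonZero d}} (d∣n : d ∣ n) where

    toℕ-mod-%∣ : ∀ x → toℕ (x mod n) % d ≡ x % d
    toℕ-mod-%∣ x = trans (cong (_% d) (toℕ-mod x)) (m∣n⇒o%n%m≡o%m d n x d∣n)

    +⊖-%∣ : ∀ l → (toℕ l + toℕ (⊖_ n l)) % d ≡ 0
    +⊖-%∣ l = begin
      (toℕ l + toℕ (⊖_ n l)) % d  ≡⟨ %-cong-+ d {toℕ l} refl (toℕ-mod-%∣ (n ∸ toℕ l)) ⟩
      (toℕ l + (n ∸ toℕ l)) % d   ≡⟨ cong (_% d) (m+[n∸m]≡n (toℕ≤n l)) ⟩
      n % d                       ≡⟨ n∣m⇒m%n≡0 n d d∣n ⟩
      0                           ∎
      where open ≡-Reasoning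

  toℕ-e : toℕ (proj₁ (e n)) ≡ 0
  toℕ-e = trans (toℕ-mod 0) (m*n%n≡0 0 n)

  rotⁿ≡e : rot n ≡ e n
  rotⁿ≡e = cong (_, false) (mod-≡ (trans (n%n≡0 n) (sym (m*n%n≡0 0 n))))

  e⁻≡e : e n ⁻ ≡ e n
  e⁻≡e = trans (cong (λ z → rot (n ∸ z)) toℕ-e) rotⁿ≡e

  record IsSubgroup (S : D n → Set) : Set where
    field
      e∈       : S (e n)
      ∙-closed : ∀ {x y} → S x → S y → S (x ∙ y)
      ⁻-closed : ∀ {x} → S x → S (x ⁻)

  ⟨⟩-least : ∀ {S P} → IsSubgroup S → (∀ {x} → P x ≡ true → S x) → ∀ {x} → x ∈⟪ P ⟫ → S x
  ⟨⟩-least S-sub P⊆S (base Px)  = P⊆S Px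
  ⟨⟩-least S-sub P⊆S unit       = IsSubgroup.e∈ S-sub
  ⟨⟩-least S-sub P⊆S (mul x∈ y∈) = IsSubgroup.∙-closed S-sub (⟨⟩-least S-sub P⊆S x∈) (⟨⟩-least S-sub P⊆S y∈)
  ⟨⟩-least S-sub P⊆S (inv x∈)   = IsSubgroup.⁻-closed S-sub (⟨⟩-least S-sub P⊆S x∈)

  ⟨⟩-mono : ∀ {P Q} → (∀ {x} → P x ≡ true → x ∈⟪ Q ⟫) → ∀ {x} → x ∈⟪ P ⟫ → x ∈⟪ Q ⟫
  ⟨⟩-mono = ⟨⟩-least (record { e∈ = unit ; ∙-closed = mul ; ⁻-closed = inv })

  rot-*-∈ : ∀ {Q} a j → rot a ∈⟪ Q ⟫ → rot (j * a) ∈⟪ Q ⟫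
  rot-*-∈ a zero    _  = unit
  rot-*-∈ {Q} a (suc j) a∈ = subst (_∈⟪ Q ⟫) (rot-+ a (j * a)) (mul a∈ (rot-*-∈ a j a∈))

  rot-∸-∈ : ∀ {Q} g b → rot (g + b) ∈⟪ Q ⟫ → rot b ∈⟪ Q ⟫ → rot g ∈⟪ Q ⟫
  rot-∸-∈ {Q} g b g+b∈ b∈ = subst (_∈⟪ Q ⟫) g+b-b≡g (mul g+b∈ (inv b∈))
    where
    open ≡-Reasoning
    g+b-b≡g : rot (g + b) ∙ rot b ⁻ ≡ rot g
    g+b-b≡g = begin
      rot (g + b) ∙ rot b ⁻           ≡⟨ cong (rot (g + b) ∙_) (rot-⁻ b) ⟩
      rot (g + b) ∙ rot (n ∸ b % n)   ≡⟨ rot-+ (g + b) _ ⟩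
      rot (g + b + (n ∸ b % n))       ≡⟨ cong rot (+-assoc g b _) ⟩
      rot (g + (b + (n ∸ b % n)))     ≡⟨ cong (_, false) (mod-≡ (%-cong-+ n {g} refl
                                           (%-cong-+ n {b} (sym (m%n%n≡m%n b n)) refl))) ⟩
      rot (g + (b % n + (n ∸ b % n))) ≡⟨ cong (λ z → rot (g + z)) (m+[n∸m]≡n (m%n≤n b n)) ⟩
      rot (g + n)                     ≡⟨ cong (_, false) (mod-≡ ([m+n]%n≡m%n g n)) ⟩
      rot g                           ∎

  rot-gcd-∈ : ∀ {Q} a b → rot a ∈⟪ Q ⟫ → rot b ∈⟪ Q ⟫ → rot (gcd a b) ∈⟪ Q ⟫
  rot-gcd-∈ {Q} a b a∈ b∈ with Bézout.identity (gcd-GCD a b)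
  ... | Bézout.+- x y eq = rot-∸-∈ (gcd a b) (y * b) (subst (λ z → rot z ∈⟪ Q ⟫) (sym eq) (rot-*-∈ a x a∈)) (rot-*-∈ b y b∈)
  ... | Bézout.-+ x y eq = rot-∸-∈ (gcd a b) (x * a) (subst (λ z → rot z ∈⟪ Q ⟫) (sym eq) (rot-*-∈ b y b∈)) (rot-*-∈ a x a∈)

  r-and-reflection-generate : ∀ {Q} a → rot 1 ∈⟪ Q ⟫ → (a , true) ∈⟪ Q ⟫ → Generates n Q
  r-and-reflection-generate {Q} a r∈ s∈ (l , false) =
    subst (_∈⟪ Q ⟫) (trans (cong rot (*-identityʳ (toℕ l))) (rot-toℕ l)) (rot-*-∈ 1 (toℕ l) r∈)
  r-and-reflection-generate {Q} a r∈ s∈ (l , true) = subst (_∈⟪ Q ⟫) rᵐs≡rˡs (mul (rot-*-∈ 1 m r∈) s∈)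
    where
    open ≡-Reasoning
    m = toℕ l + (n ∸ toℕ a)
    rᵐs≡rˡs : rot (m * 1) ∙ (a , true) ≡ (l , true)
    rᵐs≡rˡs = cong (_, true) (begin
      (toℕ (m * 1 mod n) + toℕ a) mod n ≡⟨ mod-≡ (%-cong-+ n (trans (toℕ-mod-% (m * 1)) (cong (_% n) (*-identityʳ m)))
                                                           refl) ⟩
      (m + toℕ a) mod n                 ≡⟨ cong (_mod n) (trans (+-assoc (toℕ l) _ _)
                                                                (cong (toℕ l +_) (m∸n+n≡m (toℕ≤n a)))) ⟩
      (toℕ l + n) mod n                 ≡⟨ mod-≡ ([m+n]%n≡m%n (toℕ l) n) ⟩
      toℕ l mod n                       ≡⟨ toℕ-mod-toℕ l ⟩
      l                                 ∎)

  IsRotation : D n → Set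
  IsRotation (_ , b) = b ≡ false

  rotations-isSubgroup : IsSubgroup IsRotation
  rotations-isSubgroup = record { e∈ = refl ; ∙-closed = ∙-closed ; ⁻-closed = ⁻-closed }
    where
    ∙-closed : ∀ {x y} → IsRotation x → IsRotation y → IsRotation (x ∙ y)
    ∙-closed {_ , false} _ y-rot = y-rot
    ⁻-closed : ∀ {x} → IsRotation x → IsRotation (x ⁻)
    ⁻-closed {_ , false} _ = refl

  module Coset (d : ℕ) {{_ : NonZero d}} (d∣n : d ∣ n) (a : ℕ) where

    -- the subgroup ⟨r^d , r^a f⟩
    InCoset : D n → Set
    InCoset (k , false) = toℕ k % d ≡ 0
    InCoset (k , true)  = toℕ k % d ≡ a % d

    ⊖-%d : ∀ l → toℕ l % d ≡ 0 → toℕ (⊖_ n l) % d ≡ 0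
    ⊖-%d l l≡0 = trans (sym (+-%-zeroˡ d l≡0)) (+⊖-%∣ d d∣n l)

    coset-isSubgroup : IsSubgroup InCoset
    coset-isSubgroup = record { e∈ = trans (toℕ-mod-%∣ d d∣n 0) (m*n%n≡0 0 d) ; ∙-closed = ∙-closed ; ⁻-closed = ⁻-closed }
      where
      ∙-closed : ∀ {x y} → InCoset x → InCoset y → InCoset (x ∙ y)
      ∙-closed {k , false} {l , false} k≡0 l≡0 = trans (toℕ-mod-%∣ d d∣n _) (trans (+-%-zeroˡ d k≡0) l≡0)
      ∙-closed {k , false} {l , true}  k≡0 l≡a = trans (toℕ-mod-%∣ d d∣n _) (trans (+-%-zeroˡ d k≡0) l≡a)
      ∙-closed {k , true}  {l , false} k≡a l≡0 = trans (toℕ-mod-%∣ d d∣n _)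
        (trans (cong (_% d) (+-comm (toℕ k) _)) (trans (+-%-zeroˡ d (⊖-%d l l≡0)) k≡a))
      ∙-closed {k , true}  {l , true}  k≡a l≡a = trans (toℕ-mod-%∣ d d∣n _)
        (trans (%-cong-+ d (trans k≡a (sym l≡a)) refl) (+⊖-%∣ d d∣n l))
      ⁻-closed : ∀ {x} → InCoset x → InCoset (x ⁻)
      ⁻-closed {k , false} k≡0 = ⊖-%d k k≡0
      ⁻-closed {k , true}  k≡a = k≡a

    r∉coset : d ≢ 1 → ¬ InCoset (rot 1)
    r∉coset d≢1 r∈ = d≢1 (∣1⇒≡1 (m%n≡0⇒n∣m 1 d (trans (sym (toℕ-mod-%∣ d d∣n 1)) r∈)))

  toℕ-half : ∀ {m} → n ≡ m + m → toℕ (m mod n) ≡ m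
  toℕ-half {m} n≡m+m = trans (toℕ-mod m) (m<n⇒m%n≡m (subst (m <_) (sym n≡m+m) (m<m+n m (n≢0⇒n>0 m≢0))))
    where
    m≢0 : m ≢ 0
    m≢0 refl = ≢-nonZero⁻¹ n n≡m+m

  ∸-%-≡ : ∀ {t} → 0 < t → t ≤ n → (n ∸ t) % n ≡ n ∸ t
  ∸-%-≡ 0<t t≤n = m<n⇒m%n≡m (∸-monoʳ-< 0<t t≤n)

  ⊖-involutive : ∀ k → ⊖_ n (⊖_ n k) ≡ k
  ⊖-involutive k = toℕ-injective (trans (toℕ-mod _) (trans (cong (λ z → (n ∸ z) % n) (toℕ-mod _)) (lemma (toℕ k) (toℕ<n k))))
    where
    lemma : ∀ t → t < n → (n ∸ (n ∸ t) % n) % n ≡ t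
    lemma zero    _   = trans (cong (λ z → (n ∸ z) % n) (n%n≡0 n)) (n%n≡0 n)
    lemma (suc t) t<n = begin
      (n ∸ (n ∸ suc t) % n) % n  ≡⟨ cong (λ z → (n ∸ z) % n) (∸-%-≡ z<s (<⇒≤ t<n)) ⟩
      (n ∸ (n ∸ suc t)) % n      ≡⟨ cong (_% n) (m∸[m∸n]≡n (<⇒≤ t<n)) ⟩
      suc t % n                  ≡⟨ m<n⇒m%n≡m t<n ⟩
      suc t                      ∎
      where open ≡-Reasoning

  ⁻-involutive : ∀ x → x ⁻ ⁻ ≡ x
  ⁻-involutive (k , false) = cong (_, false) (⊖-involutive k)
  ⁻-involutive (k , true)  = refl

  ⁻-fixed : ∀ k → (k , false) ⁻ ≡ (k , false) → toℕ k ≡ 0 ⊎ toℕ k + toℕ k ≡ n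
  ⁻-fixed k fixed with toℕ k | toℕ<n k | trans (sym (toℕ-mod (n ∸ toℕ k))) (cong (toℕ ∘ proj₁) fixed)
  ... | zero  | _   | _         = inj₁ refl
  ... | suc t | t<n | n∸t%n≡t = inj₂ (trans (cong (_+ suc t) (sym (trans (sym (∸-%-≡ z<s (<⇒≤ t<n))) n∸t%n≡t)))
                                          (m∸n+n≡m (<⇒≤ t<n)))

  ⊕-⊕-cancel : ∀ k x y → (toℕ x + toℕ y) % n ≡ 0 → _⊕_ n (_⊕_ n k x) y ≡ k
  ⊕-⊕-cancel k x y x+y≡0 = begin
    (toℕ (_⊕_ n k x) + toℕ y) mod n ≡⟨ mod-≡ (%-cong-+ n (toℕ-mod-% (toℕ k + toℕ x)) refl) ⟩
    (toℕ k + toℕ x + toℕ y) mod n   ≡⟨ cong (_mod n) (+-assoc (toℕ k) _ _) ⟩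
    (toℕ k + (toℕ x + toℕ y)) mod n ≡⟨ mod-≡ (+-%-zeroʳ n x+y≡0) ⟩
    toℕ k mod n                     ≡⟨ toℕ-mod-toℕ k ⟩
    k                               ∎
    where open ≡-Reasoning

  ∙-refl-involutive : ∀ a x → x ∙ (a , true) ∙ (a , true) ≡ x
  ∙-refl-involutive a (k , false) = cong (_, false) (⊕-⊕-cancel k a (⊖_ n a) (+⊖-%∣ n ∣-refl a))
  ∙-refl-involutive a (k , true)  = cong (_, true) (⊕-⊕-cancel k (⊖_ n a) a
                                      (trans (cong (_% n) (+-comm (toℕ (⊖_ n a)) (toℕ a))) (+⊖-%∣ n ∣-refl a)))

-- Positions of GEN(D_n)

module Positions (n : ℕ) {{_ : NonZero n}} where
  open Dihedral n public
  open Counting (_≟D_ n) public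

  elems-unique : Unique (elems n)
  elems-unique = cartesianProduct⁺ (allFin⁺ n) (((λ ()) ∷ []) ∷ [] ∷ [])

  elems-complete : ∀ x → x ∈ elems n
  elems-complete (k , false) = ∈-cartesianProduct⁺ (∈-allFin k) (here refl)
  elems-complete (k , true)  = ∈-cartesianProduct⁺ (∈-allFin k) (there (here refl))

  length-elems : length (elems n) ≡ n + n
  length-elems = trans (length-×-bools (allFin n)) (cong (λ m → m + m) (length-tabulate {n = n} id))
    where
    length-×-bools : ∀ (ks : List (Fin n)) → length (cartesianProduct ks (false ∷ true ∷ [])) ≡ length ks + length ks
    length-×-bools []       = refl
    length-×-bools (k ∷ ks) = cong suc (trans (cong suc (length-×-bools ks)) (sym (+-suc (length ks) (length ks))))

  size free : SubsetD n → ℕ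
  size P = count P (elems n)
  free P = count (not ∘ P) (elems n)

  even-free : ∀ P → even (free P) ≡ even (size P)
  even-free P = sym (even-+-true (size P) (free P)
    (trans (cong even (trans (count-+-count-not P (elems n)) length-elems)) (even-double n)))

  free-∅ : free (∅ n) ≡ n + n
  free-∅ = trans (count-true (elems n)) length-elems

  free≡0⇒generates : ∀ {P} → free P ≡ 0 → Generates n P
  free≡0⇒generates {P} P-full x = base (not-injective (count-zero⇒false (not ∘ P) P-full (elems-complete x)))

  insert-self : ∀ g P → insert n g P g ≡ true
  insert-self g P with _≟D_ n g g
  ... | yes _   = refl
  ... | no g≢g = contradiction refl g≢g

  insert-keep : ∀ g P {x} → P x ≡ true → insert n g P x ≡ true
  insert-keep g P {x} Px with _≟D_ n x g
  ... | yes _ = refl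
  ... | no _  = Px

  insert-≢ : ∀ g P {x} → x ≢ g → insert n g P x ≡ P x
  insert-≢ g P {x} x≢g with _≟D_ n x g
  ... | yes x≡g = contradiction x≡g x≢g
  ... | no _    = refl

  insert-true : ∀ g P {x} → insert n g P x ≡ true → x ≡ g ⊎ P x ≡ true
  insert-true g P {x} h with _≟D_ n x g
  ... | yes x≡g = inj₁ x≡g
  ... | no _    = inj₂ h

  free-insert : ∀ {g P} → P g ≡ false → free P ≡ suc (free (insert n g P))
  free-insert {g} {P} Pg = trans (count-without (elems n) elems-unique (elems-complete g) (cong not Pg))
                                 (cong suc (count-cong (elems n) λ {y} _ → pointwise y))
    where
    pointwise : ∀ y → ((not ∘ P) without g) y ≡ not (insert n g P y)
    pointwise y with _≟D_ n y g
    ... | yes _ = refl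
    ... | no _  = refl

  free-insert-≡ : ∀ {g P k} → free P ≡ suc k → P g ≡ false → free (insert n g P) ≡ k
  free-insert-≡ #P Pg = suc-injective (trans (sym (free-insert Pg)) #P)

  ⟨⟩-insert : ∀ {g P x} → x ∈⟪ P ⟫ → x ∈⟪ insert n g P ⟫
  ⟨⟩-insert {g} {P} = ⟨⟩-mono (λ Px → base (insert-keep g P Px))

  maximal-nongenerating⇒even-free : ∀ {P a} → P (a , true) ≡ true → ¬ Generates n P →
                                    (∀ {g} → P g ≡ false → Generates n (insert n g P)) → even (free P) ≡ true
  maximal-nongenerating⇒even-free {P} {a} Ps ¬gen maximal = even-count (not ∘ P) complement-closed (λ {x} _ → ∙s-free x)
    where
    s = (a , true)
    open Involution (elems n) elems-unique elems-complete (_∙ s) (∙-refl-involutive a)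
    P-closed : ∀ {x} → P x ≡ true → P (x ∙ s) ≡ true
    P-closed {x} Px with P (x ∙ s) in Pxs
    ... | true  = refl
    ... | false = contradiction (λ y → ⟨⟩-mono inserted∈⟨P⟩ (maximal Pxs y)) ¬gen
      where
      inserted∈⟨P⟩ : ∀ {y} → insert n (x ∙ s) P y ≡ true → y ∈⟪ P ⟫
      inserted∈⟨P⟩ {y} h with insert-true (x ∙ s) P h
      ... | inj₁ refl = mul (base Px) (base Ps)
      ... | inj₂ Py   = base Py
    complement-closed : ∀ {x} → not (P x) ≡ true → not (P (x ∙ s)) ≡ true
    complement-closed {x} ¬Px with P (x ∙ s) in Pxs
    ... | false = refl
    ... | true  = case trans (sym ¬Px) (cong not (subst (λ y → P y ≡ true) (∙-refl-involutive a x) (P-closed Pxs)))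
                  of λ ()
    ∙s-free : ∀ x → x ∙ s ≢ x
    ∙s-free (_ , false) ()
    ∙s-free (_ , true)  ()

  module RotationSubgroup (P : SubsetD n) (no-reflection : ∀ l → P (l , true) ≡ false)
                          (⁻-closed : ∀ {x} → P x ≡ true → P (x ⁻) ≡ true) (e∈P : P (e n) ≡ true) where

    -- Inversion pairs off the elements of P other than e and, when n = m + m, r^m.
    open Involution (elems n) elems-unique elems-complete _⁻ ⁻-involutive

    private
      P′ : SubsetD n
      P′ = P without e n

      size-P : size P ≡ suc (count P′ (elems n))
      size-P = count-without (elems n) elems-unique (elems-complete (e n)) e∈P

      P′-closed : Closed P′
      P′-closed = without-fixed-closed {P} e⁻≡e ⁻-closed

      P′-fixed : ∀ {x} → P′ x ≡ true → x ⁻ ≡ x → ∃ λ k → x ≡ (k , false) × toℕ k + toℕ k ≡ n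
      P′-fixed {k , true}  P′x _ = contradiction (trans (sym (proj₁ (without-true P P′x))) (no-reflection k)) λ ()
      P′-fixed {k , false} P′x fixed with ⁻-fixed k fixed
      ... | inj₁ k≡0   = contradiction (trans (sym (rot-toℕ k)) (cong rot k≡0)) (proj₂ (without-true P P′x))
      ... | inj₂ k+k≡n = k , refl , k+k≡n

    even-size-odd-order : even n ≡ false → even (size P) ≡ false
    even-size-odd-order n-odd = trans (cong even size-P) (cong not (even-count P′ P′-closed P′-free))
      where
      P′-free : FixedPointFree P′
      P′-free P′x fixed with P′-fixed P′x fixed
      ... | k , refl , k+k≡n = contradiction (trans (sym n-odd) (trans (sym (cong even k+k≡n)) (even-double (toℕ k)))) λ ()

    module _ (m : ℕ) (n≡m+m : n ≡ m + m) where

      private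
        half⁻≡half : rot m ⁻ ≡ rot m
        half⁻≡half = trans (rot-⁻ m) (cong rot (trans (cong (n ∸_) (trans (sym (toℕ-mod m)) (toℕ-half n≡m+m)))
                                                     (trans (cong (_∸ m) n≡m+m) (m+n∸n≡m m m))))

        half≢e : rot m ≢ e n
        half≢e half≡e = ≢-nonZero⁻¹ n (trans n≡m+m (cong (λ z → z + z) m≡0))
          where
          m≡0 : m ≡ 0
          m≡0 = trans (sym (toℕ-half n≡m+m)) (trans (cong (toℕ ∘ proj₁) half≡e) toℕ-e)

        P″ : SubsetD n
        P″ = P′ without rot m

        P″-free : FixedPointFree P″
        P″-free P″x fixed with without-true P′ P″x
        ... | P′x , x≢half with P′-fixed P′x fixed
        ... | k , refl , k+k≡n = x≢half (trans (sym (rot-toℕ k)) (cong rot (+-double-injective (trans k+k≡n n≡m+m))))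

        even-P″ : even (count P″ (elems n)) ≡ true
        even-P″ = even-count P″ (λ {x} → without-fixed-closed {P′} half⁻≡half P′-closed {x}) P″-free

      even-size-even-order : even (size P) ≡ P (rot m)
      even-size-even-order with P (rot m) in Ph
      ... | true  = trans (cong even (trans size-P (cong suc (count-without (elems n) elems-unique
                                                                (elems-complete (rot m)) (trans (without-≢ P half≢e) Ph)))))
                          (trans (not-involutive _) even-P″)
      ... | false = trans (cong even (trans size-P (cong suc (count-cong (elems n) λ {y} _ → P′≗P″ y))))
                          (cong not even-P″)
        where
        P′≗P″ : ∀ y → P′ y ≡ P″ y
        P′≗P″ y with _≟D_ n y (rot m)
        ... | yes refl = trans (without-≢ P half≢e) Ph
        ... | no _     = refl

  ∃-dec : ∀ {Q : D n → Set} → (∀ x → Dec (Q x)) → Dec (∃ Q)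
  ∃-dec Q? with any? Q? (elems n)
  ... | yes found = yes (satisfied found)
  ... | no none   = no λ (x , Qx) → none (lose (elems-complete x) Qx)

  HasReflection : SubsetD n → Set
  HasReflection P = ∃ λ a → P (a , true) ≡ true

  rotations-nongenerating : ∀ {P} → (∀ l → P (l , true) ≡ false) → ¬ Generates n P
  rotations-nongenerating {P} no-reflection gen =
    contradiction (⟨⟩-least rotations-isSubgroup P-rotations (gen (e n ⁻ ∙ (0 mod n , true)))) λ ()
    where
    P-rotations : ∀ {x} → P x ≡ true → IsRotation x
    P-rotations {l , false} _  = refl
    P-rotations {l , true}  Px = contradiction (trans (sym Px) (no-reflection l)) λ ()

  record Generates⟨r^_⟩ (d : ℕ) (P : SubsetD n) : Set where
    field
      no-reflection : ∀ l → P (l , true) ≡ false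
      d∣n           : d ∣ n
      d∣rotations   : ∀ l → P (l , false) ≡ true → d ∣ toℕ l
      rᵈ∈⟨P⟩        : rot d ∈⟪ P ⟫

  ∅-generates⟨r^n⟩ : Generates⟨r^ n ⟩ (∅ n)
  ∅-generates⟨r^n⟩ = record
    { no-reflection = λ _ → refl
    ; d∣n           = ∣-refl
    ; d∣rotations   = λ _ ()
    ; rᵈ∈⟨P⟩        = subst (_∈⟪ ∅ n ⟫) (sym rotⁿ≡e) unit
    }

-- Nim-values

module Game (n : ℕ) {{_ : NonZero n}} (gen? : (P : SubsetD n) → Dec (Generates n P)) where
  open Positions n public

  nim : ℕ → SubsetD n → ℕ
  nim = nimF n gen?

  record OptionValue (k : ℕ) (P : SubsetD n) (j : ℕ) : Set where
    constructor option
    field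
      move       : D n
      move-free  : P move ≡ false
      move-value : nim k (insert n move P) ≡ j

  nim-generating : ∀ k {P} → Generates n P → nim k P ≡ 0
  nim-generating zero    _   = refl
  nim-generating (suc k) {P} gen with gen? P
  ... | yes _   = refl
  ... | no ¬gen = contradiction gen ¬gen

  Below : ℕ → SubsetD n → ℕ → Set
  Below k P v = ∀ j → j < v → OptionValue k P j

  below₀ : ∀ {k P} → Below k P 0
  below₀ _ ()

  below₁ : ∀ {k P} → OptionValue k P 0 → Below k P 1
  below₁ o₀ 0 _ = o₀
  below₁ _ (suc _) (s≤s ())

  below₂ : ∀ {k P} → OptionValue k P 0 → OptionValue k P 1 → Below k P 2
  below₂ o₀ o₁ 0 _ = o₀
  below₂ o₀ o₁ 1 _ = o₁
  below₂ _ _ (suc (suc _)) (s≤s (s≤s ()))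

  below₃ : ∀ {k P} → OptionValue k P 0 → OptionValue k P 1 → OptionValue k P 2 → Below k P 3
  below₃ o₀ o₁ o₂ 0 _ = o₀
  below₃ o₀ o₁ o₂ 1 _ = o₁
  below₃ o₀ o₁ o₂ 2 _ = o₂
  below₃ _ _ _ (suc (suc (suc _))) (s≤s (s≤s (s≤s ())))

  nim-≡ : ∀ {k P} v → v ≤ 3 → ¬ Generates n P → ¬ OptionValue k P v → Below k P v → nim (suc k) P ≡ v
  nim-≡ {k} {P} v v≤3 ¬gen no-v below with gen? P
  ... | yes gen = contradiction gen ¬gen
  ... | no _    = mex-≡ v v≤3 (λ j j<v → option∈ (below j j<v)) (no-v ∘ ∈option)
    where
    value : D n → ℕ
    value g = nim k (insert n g P)
    open-moves : D n → Bool
    open-moves g = not (P g)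
    option∈ : ∀ {j} → OptionValue k P j → j ∈ map value (filterᵇ open-moves (elems n))
    option∈ (option g Pg refl) = ∈-map⁺ value (∈-filter⁺ (T? ∘ open-moves) (elems-complete g) (subst (T ∘ not) (sym Pg) tt))
    ∈option : ∀ {j} → j ∈ map value (filterᵇ open-moves (elems n)) → OptionValue k P j
    ∈option j∈ with ∈-map⁻ value j∈
    ... | g , g∈ , refl = option g (T-not⇒≡false (proj₂ (∈-filter⁻ (T? ∘ open-moves) {xs = elems n} g∈))) refl

  vRefl : Bool → ℕ
  vRefl b = if b then 1 else 2

  ReflectionInvariant : ℕ → Set
  ReflectionInvariant k = ∀ Q → free Q ≡ k → HasReflection Q → ¬ Generates n Q → nim k Q ≡ vRefl (even k)

  reflection-step : ∀ {k} → ReflectionInvariant k → ReflectionInvariant (suc k)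
  reflection-step {k} ih P #P (a , Pa) ¬gen = step (even k) refl
    where
    r∉P : P (rot 1) ≡ false
    r∉P with P (rot 1) in Pr
    ... | true  = contradiction (r-and-reflection-generate a (base Pr) (base Pa)) ¬gen
    ... | false = refl

    r-option : OptionValue k P 0
    r-option = option (rot 1) r∉P
      (nim-generating k (r-and-reflection-generate a (base (insert-self _ P)) (base (insert-keep _ P Pa))))

    nongenerating-value : ∀ {g} → P g ≡ false → ¬ Generates n (insert n g P) → nim k (insert n g P) ≡ vRefl (even k)
    nongenerating-value {g} Pg = ih _ (free-insert-≡ #P Pg) (a , insert-keep g P Pa)

    options : ∀ {j} → OptionValue k P j → j ≡ 0 ⊎ j ≡ vRefl (even k)
    options (option g Pg refl) with gen? (insert n g P)
    ... | yes gen  = inj₁ (nim-generating k gen)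
    ... | no ¬gen′ = inj₂ (nongenerating-value Pg ¬gen′)

    -- If every move generated, P would be closed under right multiplication by (a , true),
    -- which then pairs off the free elements.
    nongenerating-option : even k ≡ true → OptionValue k P (vRefl (even k))
    nongenerating-option even-k with ∃-dec (λ g → (P g ≟B false) ×-dec ¬? (gen? (insert n g P)))
    ... | yes (g , Pg , ¬gen′) = option g Pg (nongenerating-value Pg ¬gen′)
    ... | no none = contradiction (maximal-nongenerating⇒even-free Pa ¬gen maximal)
                                  (λ even-free → case trans (sym even-free) (trans (cong even #P) (cong not even-k)) of λ ())
      where
      maximal : ∀ {g} → P g ≡ false → Generates n (insert n g P)
      maximal {g} Pg with gen? (insert n g P)
      ... | yes gen  = gen
      ... | no ¬gen′ = contradiction (g , Pg , ¬gen′) none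

    step : ∀ b → even k ≡ b → nim (suc k) P ≡ vRefl (not b)
    step true even-k = nim-≡ 2 (s≤s (s≤s z≤n)) ¬gen no-2
      (below₂ r-option (subst (OptionValue k P ∘ vRefl) even-k (nongenerating-option even-k)))
      where
      no-2 : ¬ OptionValue k P 2
      no-2 opt with options opt
      ... | inj₂ 2≡vRefl = case trans 2≡vRefl (cong vRefl even-k) of λ ()
    step false even-k = nim-≡ 1 (s≤s z≤n) ¬gen no-1 (below₁ r-option)
      where
      no-1 : ¬ OptionValue k P 1
      no-1 opt with options opt
      ... | inj₂ 1≡vRefl = case trans 1≡vRefl (cong vRefl even-k) of λ ()

  reflection-invariant : ∀ k → ReflectionInvariant k
  reflection-invariant zero    Q #Q _ ¬gen = contradiction (free≡0⇒generates #Q) ¬gen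
  reflection-invariant (suc k) = reflection-step (reflection-invariant k)

  RotationInvariant : (ℕ → Bool → ℕ) → ℕ → Set
  RotationInvariant vRot k = ∀ Q d → free Q ≡ k → Generates⟨r^ d ⟩ Q → nim k Q ≡ vRot d (even k)

  module RotationPosition {vRot : ℕ → Bool → ℕ} {k} (ih : RotationInvariant vRot k) {P d}
                          (span : Generates⟨r^ d ⟩ P) (#P : free P ≡ suc k) {b} (even-k : even k ≡ b) where
    open Generates⟨r^_⟩ span

    d≢0 : d ≢ 0
    d≢0 refl = ≢-nonZero⁻¹ n (0∣⇒≡0 d∣n)

    instance
      d-nonZero : NonZero d
      d-nonZero = ≢-nonZero d≢0

    reflection-value-d≡1 : d ≡ 1 → ∀ a → nim k (insert n (a , true) P) ≡ 0
    reflection-value-d≡1 refl a =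
      nim-generating k (r-and-reflection-generate a (⟨⟩-insert rᵈ∈⟨P⟩) (base (insert-self _ P)))

    reflection-nongenerating : d ≢ 1 → ∀ a → ¬ Generates n (insert n (a , true) P)
    reflection-nongenerating d≢1 a gen = r∉coset d≢1 (⟨⟩-least coset-isSubgroup inserted⊆ (gen (rot 1)))
      where
      open Coset d d∣n (toℕ a)
      inserted⊆ : ∀ {x} → insert n (a , true) P x ≡ true → InCoset x
      inserted⊆ {x} h with insert-true (a , true) P h
      ... | inj₁ refl = refl
      inserted⊆ {l , true}  _ | inj₂ Px = contradiction (trans (sym Px) (no-reflection l)) λ ()
      inserted⊆ {l , false} _ | inj₂ Px = n∣m⇒m%n≡0 (toℕ l) d (d∣rotations l Px)

    reflection-value-d≢1 : d ≢ 1 → ∀ a → nim k (insert n (a , true) P) ≡ vRefl b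
    reflection-value-d≢1 d≢1 a = trans (reflection-invariant k _ (free-insert-≡ #P (no-reflection a)) (a , insert-self _ P)
                                                            (reflection-nongenerating d≢1 a))
                                       (cong vRefl even-k)

    insert-rotation : ∀ l → Generates⟨r^ gcd (toℕ l) d ⟩ (insert n (l , false) P)
    insert-rotation l = record
      { no-reflection = λ l′ → trans (insert-≢ _ P λ ()) (no-reflection l′)
      ; d∣n           = ∣-trans (gcd[m,n]∣n (toℕ l) d) d∣n
      ; d∣rotations   = λ l′ h → [ (λ { refl → gcd[m,n]∣m (toℕ l) d })
                                   , (λ Pl′ → ∣-trans (gcd[m,n]∣n (toℕ l) d) (d∣rotations l′ Pl′)) ]′ (insert-true _ P h)
      ; rᵈ∈⟨P⟩        = rot-gcd-∈ (toℕ l) d (subst (_∈⟪ insert n (l , false) P ⟫) (sym (rot-toℕ l)) (base (insert-self _ P)))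
                                  (⟨⟩-insert rᵈ∈⟨P⟩)
      }

    rotation-value : ∀ l → P (l , false) ≡ false → nim k (insert n (l , false) P) ≡ vRot (gcd (toℕ l) d) b
    rotation-value l Pl = trans (ih _ _ (free-insert-≡ #P Pl) (insert-rotation l)) (cong (vRot _) even-k)

    nim-rotation-≡ : ∀ v → v ≤ 3 → (d ≡ 1 → 0 ≢ v) → (d ≢ 1 → vRefl b ≢ v) →
                     (∀ l → P (l , false) ≡ false → vRot (gcd (toℕ l) d) b ≢ v) →
                     Below k P v → nim (suc k) P ≡ v
    nim-rotation-≡ v v≤3 0≢v vRefl≢v rotation-≢v below = nim-≡ v v≤3 (rotations-nongenerating no-reflection) no-v below
      where
      no-v : ¬ OptionValue k P v
      no-v (option (a , true) _ refl) with d ≟ℕ 1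
      ... | yes d≡1 = 0≢v d≡1 (sym (reflection-value-d≡1 d≡1 a))
      ... | no d≢1  = vRefl≢v d≢1 (sym (reflection-value-d≢1 d≢1 a))
      no-v (option (l , false) Pl refl) = rotation-≢v l Pl (sym (rotation-value l Pl))

    rotation-values-∉ : ∀ {vs v} → (∀ x → vRot x b ∈ vs) → v ∈ᵇ vs ≡ false →
                        ∀ l → P (l , false) ≡ false → vRot (gcd (toℕ l) d) b ≢ v
    rotation-values-∉ range v∉vs l _ = ∈-∉ᵇ⇒≢ (range (gcd (toℕ l) d)) v∉vs

    reflection-option-d≡1 : d ≡ 1 → OptionValue k P 0
    reflection-option-d≡1 d≡1 = option (0 mod n , true) (no-reflection _) (reflection-value-d≡1 d≡1 _)

    reflection-option-d≢1 : d ≢ 1 → OptionValue k P (vRefl b)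
    reflection-option-d≢1 d≢1 = option (0 mod n , true) (no-reflection _) (reflection-value-d≢1 d≢1 _)

    rotation-option : ∀ l → P (l , false) ≡ false → OptionValue k P (vRot (gcd (toℕ l) d) b)
    rotation-option l Pl = option (l , false) Pl (rotation-value l Pl)

    small-rotation-option : ∀ j → 0 < j → j < d → OptionValue k P (vRot (gcd j d) b)
    small-rotation-option j 0<j j<d = subst (λ t → OptionValue k P (vRot (gcd t d) b)) toℕ-j (rotation-option (j mod n) Pj)
      where
      toℕ-j : toℕ (j mod n) ≡ j
      toℕ-j = trans (toℕ-mod j) (m<n⇒m%n≡m (<-≤-trans j<d (∣⇒≤ d∣n)))
      Pj : P (j mod n , false) ≡ false
      Pj with P (j mod n , false) in Pj
      ... | false = refl
      ... | true  = contradiction (∣⇒≤ {{>-nonZero 0<j}} (subst (d ∣_) toℕ-j (d∣rotations _ Pj))) (<⇒≱ j<d)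

    MissingMultiple : Set
    MissingMultiple = ∃ λ l → d ∣ toℕ l × P (l , false) ≡ false

    multiple-option : MissingMultiple → OptionValue k P (vRot d b)
    multiple-option (l , d∣l , Pl) = subst (λ x → OptionValue k P (vRot x b))
                                           (∣-antisym (gcd[m,n]∣n (toℕ l) d) (gcd-greatest d∣l ∣-refl))
                                           (rotation-option l Pl)

    AllMultiples : Set
    AllMultiples = ∀ l → d ∣ toℕ l → P (l , false) ≡ true

    -- If P contained every multiple of d, P would be ⟨r^d⟩, whose size has a known parity.
    missing-or-all : MissingMultiple ⊎ AllMultiples
    missing-or-all with anyFin? (λ l → (d ∣? toℕ l) ×-dec (P (l , false) ≟B false))
    ... | yes missing = inj₁ missing
    ... | no none     = inj₂ all
      where
      all : AllMultiples
      all l d∣l with P (l , false) in Pl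
      ... | true  = refl
      ... | false = contradiction (l , d∣l , Pl) none

    module _ (all : AllMultiples) where

      private
        ⁻-closed : ∀ {x} → P x ≡ true → P (x ⁻) ≡ true
        ⁻-closed {l , true}  Px = contradiction (trans (sym Px) (no-reflection l)) λ ()
        ⁻-closed {l , false} Px = all _ (m%n≡0⇒n∣m _ d (IsSubgroup.⁻-closed (Coset.coset-isSubgroup d d∣n 0) {l , false}
                                                          (n∣m⇒m%n≡0 (toℕ l) d (d∣rotations l Px))))

        e∈P : P (e n) ≡ true
        e∈P = all _ (subst (d ∣_) (sym toℕ-e) (d ∣0))

        open RotationSubgroup P no-reflection ⁻-closed e∈P

        not-b≡even-size : not b ≡ even (size P)
        not-b≡even-size = trans (cong not (sym even-k)) (trans (sym (cong even #P)) (even-free P))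

      all-multiples-odd-order : even n ≡ false → b ≡ true
      all-multiples-odd-order n-odd = not-injective (trans not-b≡even-size (even-size-odd-order n-odd))

      all-multiples-even-order : ∀ m → n ≡ m + m → not b ≡ P (rot m)
      all-multiples-even-order m n≡m+m = trans not-b≡even-size (even-size-even-order m n≡m+m)

    missing-multiple-odd-order : even n ≡ false → b ≡ false → MissingMultiple
    missing-multiple-odd-order n-odd b≡false with missing-or-all
    ... | inj₁ missing = missing
    ... | inj₂ all     = case trans (sym b≡false) (all-multiples-odd-order all n-odd) of λ ()

    missing-multiple-d∣m : ∀ m → n ≡ m + m → d ∣ m → b ≡ true → MissingMultiple
    missing-multiple-d∣m m n≡m+m d∣m b≡true with missing-or-all
    ... | inj₁ missing = missing
    ... | inj₂ all     = case trans (cong not (sym b≡true))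
                                    (trans (all-multiples-even-order all m n≡m+m)
                                           (all _ (subst (d ∣_) (sym (toℕ-half n≡m+m)) d∣m))) of λ ()

    missing-multiple-d∤m : ∀ m → n ≡ m + m → ¬ d ∣ m → b ≡ false → MissingMultiple
    missing-multiple-d∤m m n≡m+m d∤m b≡false with missing-or-all
    ... | inj₁ missing = missing
    ... | inj₂ all with P (rot m) in Pm | all-multiples-even-order all m n≡m+m
    ...   | true  | _       = contradiction (subst (d ∣_) (toℕ-half n≡m+m) (d∣rotations _ Pm)) d∤m
    ...   | false | not-b≡f = case trans (cong not (sym b≡false)) not-b≡f of λ ()

  RotationStep : (ℕ → Bool → ℕ) → Set
  RotationStep vRot = ∀ {k} → RotationInvariant vRot k → RotationInvariant vRot (suc k)

  nimGEN≡table : ∀ {vRot} → RotationStep vRot → nimGEN n gen? ≡ vRot n true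
  nimGEN≡table {vRot} step = trans (invariant (n + n) (∅ n) n free-∅ ∅-generates⟨r^n⟩) (cong (vRot n) (even-double n))
    where
    invariant : ∀ k → RotationInvariant vRot k
    invariant zero    Q d #Q span = contradiction (free≡0⇒generates #Q)
                                                  (rotations-nongenerating (Generates⟨r^_⟩.no-reflection span))
    invariant (suc k) = step (invariant k)

-- The three residues of n modulo 4

oddTable : Bool → Bool → ℕ
oddTable true  p = if p then 2 else 1
oddTable false p = if p then 3 else 0

oddTable-range : ∀ c p → oddTable c p ∈ (oddTable true p ∷ oddTable false p ∷ [])
oddTable-range true  _ = here refl
oddTable-range false _ = there (here refl)

module OddOrder (n : ℕ) {{_ : NonZero n}} (gen? : (P : SubsetD n) → Dec (Generates n P)) (n-odd : even n ≡ false) where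
  open Game n gen?

  vOdd : ℕ → Bool → ℕ
  vOdd d = oddTable (d ≡ᵇ 1)

  vOdd-range : ∀ b x → vOdd x b ∈ (oddTable true b ∷ oddTable false b ∷ [])
  vOdd-range b x = oddTable-range (x ≡ᵇ 1) b

  odd-step : RotationStep vOdd
  odd-step {k} ih Q d #Q span = step (even k) refl (d ≡ᵇ 1) refl
    where
    step : ∀ b → even k ≡ b → ∀ c → (d ≡ᵇ 1) ≡ c → nim (suc k) Q ≡ oddTable c (not b)
    step true even-k true d≡ᵇ1 =
      nim-rotation-≡ 1 (s≤s z≤n) (λ _ ()) (contradiction (≡ᵇ-true d≡ᵇ1)) (rotation-values-∉ (vOdd-range true) refl)
        (below₁ (reflection-option-d≡1 (≡ᵇ-true d≡ᵇ1)))
      where open RotationPosition {vRot = vOdd} ih span #Q even-k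
    step false even-k true d≡ᵇ1 =
      nim-rotation-≡ 2 (s≤s (s≤s z≤n)) (λ _ ()) (contradiction (≡ᵇ-true d≡ᵇ1)) (rotation-values-∉ (vOdd-range false) refl)
        (below₂ (reflection-option-d≡1 (≡ᵇ-true d≡ᵇ1))
                (subst (λ c → OptionValue k Q (oddTable c false)) d≡ᵇ1
                       (multiple-option (missing-multiple-odd-order n-odd refl))))
      where open RotationPosition {vRot = vOdd} ih span #Q even-k
    step true even-k false d≢ᵇ1 =
      nim-rotation-≡ 0 z≤n (λ d≡1 → contradiction d≡1 (≡ᵇ-false d≢ᵇ1)) (λ _ ())
        (rotation-values-∉ (vOdd-range true) refl) below₀
      where open RotationPosition {vRot = vOdd} ih span #Q even-k
    step false even-k false d≢ᵇ1 =
      nim-rotation-≡ 3 ≤-refl (λ d≡1 → contradiction d≡1 (≡ᵇ-false d≢ᵇ1)) (λ _ ())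
        (rotation-values-∉ (vOdd-range false) refl)
        (below₃ (subst (λ c → OptionValue k Q (oddTable c false)) d≢ᵇ1
                       (multiple-option (missing-multiple-odd-order n-odd refl)))
                (subst (λ x → OptionValue k Q (vOdd x false)) (gcd-zeroˡ d)
                       (small-rotation-option 1 z<s (1<d d≢0 (≡ᵇ-false d≢ᵇ1))))
                (reflection-option-d≢1 (≡ᵇ-false d≢ᵇ1)))
      where open RotationPosition {vRot = vOdd} ih span #Q even-k

  nimGEN≡3 : n ≢ 1 → nimGEN n gen? ≡ 3
  nimGEN≡3 n≢1 = trans (nimGEN≡table {vOdd} odd-step) (cong (λ c → oddTable c true) (≢⇒≡ᵇ-false n≢1))

fourTable : Bool → Bool → ℕ
fourTable true  p = if p then 1 else 2
fourTable false p = if p then 0 else 2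

fourTable-range : ∀ c p → fourTable c p ∈ (fourTable true p ∷ fourTable false p ∷ [])
fourTable-range true  _ = here refl
fourTable-range false _ = there (here refl)

module DoublyEvenOrder (n : ℕ) {{_ : NonZero n}} (gen? : (P : SubsetD n) → Dec (Generates n P))
                       (m : ℕ) (n≡m+m : n ≡ m + m) (m-even : even m ≡ true) where
  open Game n gen?

  vFour : ℕ → Bool → ℕ
  vFour d = fourTable (d ≡ᵇ 1)

  vFour-range : ∀ b x → vFour x b ∈ (fourTable true b ∷ fourTable false b ∷ [])
  vFour-range b x = fourTable-range (x ≡ᵇ 1) b

  four-step : RotationStep vFour
  four-step {k} ih Q d #Q span = step (even k) refl (d ≡ᵇ 1) refl
    where
    step : ∀ b → even k ≡ b → ∀ c → (d ≡ᵇ 1) ≡ c → nim (suc k) Q ≡ fourTable c (not b)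
    step true even-k true d≡ᵇ1 =
      nim-rotation-≡ 2 (s≤s (s≤s z≤n)) (λ _ ()) (contradiction (≡ᵇ-true d≡ᵇ1)) (rotation-values-∉ (vFour-range true) refl)
        (below₂ (reflection-option-d≡1 (≡ᵇ-true d≡ᵇ1))
                (subst (λ c → OptionValue k Q (fourTable c true)) d≡ᵇ1
                       (multiple-option (missing-multiple-d∣m m n≡m+m (subst (_∣ m) (sym (≡ᵇ-true d≡ᵇ1)) (1∣ m)) refl))))
      where open RotationPosition {vRot = vFour} ih span #Q even-k
    step false even-k true d≡ᵇ1 =
      nim-rotation-≡ 1 (s≤s z≤n) (λ _ ()) (contradiction (≡ᵇ-true d≡ᵇ1)) (rotation-values-∉ (vFour-range false) refl)
        (below₁ (reflection-option-d≡1 (≡ᵇ-true d≡ᵇ1)))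
      where open RotationPosition {vRot = vFour} ih span #Q even-k
    step true even-k false d≢ᵇ1 =
      nim-rotation-≡ 2 (s≤s (s≤s z≤n)) (λ d≡1 → contradiction d≡1 (≡ᵇ-false d≢ᵇ1)) (λ _ ())
        (rotation-values-∉ (vFour-range true) refl) (below₂ zero-option (reflection-option-d≢1 (≡ᵇ-false d≢ᵇ1)))
      where
      open RotationPosition {vRot = vFour} ih span #Q even-k
      open Generates⟨r^_⟩ span using (d∣n)
      zero-option : OptionValue k Q 0
      zero-option with d ∣? m
      ... | yes d∣m = subst (λ c → OptionValue k Q (fourTable c true)) d≢ᵇ1
                            (multiple-option (missing-multiple-d∣m m n≡m+m d∣m refl))
      ... | no d∤m  = subst (λ c → OptionValue k Q (fourTable c true)) (≢⇒≡ᵇ-false gcd[2,d]≢1)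
                            (small-rotation-option 2 (s≤s z≤n) (2<d d≢0 (≡ᵇ-false d≢ᵇ1) d≢2))
        where
        d≢2 : d ≢ 2
        d≢2 refl = d∤m (even⇒2∣ {m} m-even)
        gcd[2,d]≢1 : gcd 2 d ≢ 1
        gcd[2,d]≢1 coprime = d∤m (coprime-divisor (gcd≡1⇒coprime (trans (gcd-comm d 2) coprime))
                                                  (subst (d ∣_) (trans n≡m+m (cong (m +_) (sym (+-identityʳ m)))) d∣n))
    step false even-k false d≢ᵇ1 =
      nim-rotation-≡ 0 z≤n (λ d≡1 → contradiction d≡1 (≡ᵇ-false d≢ᵇ1)) (λ _ ())
        (rotation-values-∉ (vFour-range false) refl) below₀
      where open RotationPosition {vRot = vFour} ih span #Q even-k

  nimGEN≡0 : n ≢ 1 → nimGEN n gen? ≡ 0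
  nimGEN≡0 n≢1 = trans (nimGEN≡table {vFour} four-step) (cong (λ c → fourTable c true) (≢⇒≡ᵇ-false n≢1))

data DivisorClass : Set where
  one two otherEven otherOdd : DivisorClass

classify : ℕ → DivisorClass
classify 0                   = otherEven
classify 1                   = one
classify 2                   = two
classify (suc (suc (suc d))) = if even d then otherOdd else otherEven

classify-one : ∀ d → classify d ≡ one → d ≡ 1
classify-one 1 _ = refl
classify-one (suc (suc (suc d))) h with even d | h
... | true  | ()
... | false | ()

classify-two : ∀ d → classify d ≡ two → d ≡ 2
classify-two 2 _ = refl
classify-two (suc (suc (suc d))) h with even d | h
... | true  | ()
... | false | ()

classify-otherOdd : ∀ d → classify d ≡ otherOdd → even d ≡ false × d ≢ 1
classify-otherOdd (suc (suc (suc d))) h with even d | h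
... | true  | _ = refl , λ ()

classify-otherEven : ∀ d → classify d ≡ otherEven → even d ≡ true × d ≢ 2
classify-otherEven 0 _ = refl , λ ()
classify-otherEven (suc (suc (suc d))) h with even d | h
... | false | _ = refl , λ ()

classify-even : ∀ {d} → 3 ≤ d → even d ≡ true → classify d ≡ otherEven
classify-even {2} (s≤s (s≤s ())) _
classify-even {suc (suc (suc d))} _ d-even with even d | d-even
... | false | _ = refl

classify-odd : ∀ {d} → even d ≡ false → d ≢ 1 → classify d ≡ otherOdd
classify-odd {1} _ d≢1 = contradiction refl d≢1
classify-odd {suc (suc (suc d))} d-odd _ with even d | d-odd
... | true | _ = refl

twoTable : DivisorClass → Bool → ℕ
twoTable one       p = if p then 1 else 2
twoTable two       p = if p then 1 else 0
twoTable otherEven p = if p then 1 else 2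
twoTable otherOdd  p = if p then 0 else 2

twoTable-range : ∀ c p → twoTable c p ∈ (twoTable one p ∷ twoTable two p ∷ twoTable otherOdd p ∷ [])
twoTable-range one       _ = here refl
twoTable-range two       _ = there (here refl)
twoTable-range otherEven _ = here refl
twoTable-range otherOdd  _ = there (there (here refl))

twoTable-false-≡0 : ∀ c → twoTable c false ≡ 0 → c ≡ two
twoTable-false-≡0 two _ = refl

module SinglyEvenOrder (n : ℕ) {{_ : NonZero n}} (gen? : (P : SubsetD n) → Dec (Generates n P))
                       (m : ℕ) (n≡m+m : n ≡ m + m) (m-odd : even m ≡ false) where
  open Game n gen?

  vTwo : ℕ → Bool → ℕ
  vTwo d = twoTable (classify d)

  vTwo-range : ∀ b x → vTwo x b ∈ (twoTable one b ∷ twoTable two b ∷ twoTable otherOdd b ∷ [])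
  vTwo-range b x = twoTable-range (classify x) b

  two-step : RotationStep vTwo
  two-step {k} ih Q d #Q span = step (even k) refl (classify d) refl
    where
    open Generates⟨r^_⟩ span using (d∣n)
    step : ∀ b → even k ≡ b → ∀ c → classify d ≡ c → nim (suc k) Q ≡ twoTable c (not b)
    step true even-k one d-one =
      nim-rotation-≡ 2 (s≤s (s≤s z≤n)) (λ _ ()) (contradiction (classify-one d d-one))
        (rotation-values-∉ (vTwo-range true) refl)
        (below₂ (reflection-option-d≡1 (classify-one d d-one))
                (subst (λ c → OptionValue k Q (twoTable c true)) d-one
                       (multiple-option (missing-multiple-d∣m m n≡m+m
                                          (subst (_∣ m) (sym (classify-one d d-one)) (1∣ m)) refl))))
      where open RotationPosition {vRot = vTwo} ih span #Q even-k
    step false even-k one d-one =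
      nim-rotation-≡ 1 (s≤s z≤n) (λ _ ()) (contradiction (classify-one d d-one)) (rotation-values-∉ (vTwo-range false) refl)
        (below₁ (reflection-option-d≡1 (classify-one d d-one)))
      where open RotationPosition {vRot = vTwo} ih span #Q even-k
    step true even-k two d-two =
      nim-rotation-≡ 0 z≤n (λ d≡1 → case trans (sym (classify-two d d-two)) d≡1 of λ ()) (λ _ ()) divisor-of-2 below₀
      where
      open RotationPosition {vRot = vTwo} ih span #Q even-k
      divisor-of-2 : ∀ l → Q (l , false) ≡ false → vTwo (gcd (toℕ l) d) true ≢ 0
      divisor-of-2 l _ with ∣2⇒≡1⊎≡2 (subst (gcd (toℕ l) d ∣_) (classify-two d d-two) (gcd[m,n]∣n (toℕ l) d))
      ... | inj₁ g≡1 = subst (λ x → vTwo x true ≢ 0) (sym g≡1) λ ()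
      ... | inj₂ g≡2 = subst (λ x → vTwo x true ≢ 0) (sym g≡2) λ ()
    step false even-k two d-two =
      nim-rotation-≡ 1 (s≤s z≤n) (λ d≡1 → case trans (sym (classify-two d d-two)) d≡1 of λ ()) (λ _ ())
        (rotation-values-∉ (vTwo-range false) refl)
        (below₁ (subst (λ c → OptionValue k Q (twoTable c false)) d-two
                       (multiple-option (missing-multiple-d∤m m n≡m+m
                                          (λ d∣m → odd⇒¬2∣ {m} m-odd (subst (_∣ m) (classify-two d d-two) d∣m)) refl))))
      where open RotationPosition {vRot = vTwo} ih span #Q even-k
    step true even-k otherOdd d-odd =
      nim-rotation-≡ 2 (s≤s (s≤s z≤n)) (λ d≡1 → contradiction d≡1 (proj₂ (classify-otherOdd d d-odd))) (λ _ ())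
        (rotation-values-∉ (vTwo-range true) refl)
        (below₂ (subst (λ c → OptionValue k Q (twoTable c true)) d-odd
                       (multiple-option (missing-multiple-d∣m m n≡m+m
                                          (odd-∣-double (proj₁ (classify-otherOdd d d-odd)) (subst (d ∣_) n≡m+m d∣n)) refl)))
                (reflection-option-d≢1 (proj₂ (classify-otherOdd d d-odd))))
      where open RotationPosition {vRot = vTwo} ih span #Q even-k
    step false even-k otherOdd d-odd =
      nim-rotation-≡ 0 z≤n (λ d≡1 → contradiction d≡1 (proj₂ (classify-otherOdd d d-odd))) (λ _ ()) odd-divisor below₀
      where
      open RotationPosition {vRot = vTwo} ih span #Q even-k
      odd-divisor : ∀ l → Q (l , false) ≡ false → vTwo (gcd (toℕ l) d) false ≢ 0
      odd-divisor l _ v≡0 = odd⇒¬2∣ {d} (proj₁ (classify-otherOdd d d-odd))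
        (subst (_∣ d) (classify-two _ (twoTable-false-≡0 (classify (gcd (toℕ l) d)) v≡0)) (gcd[m,n]∣n (toℕ l) d))
    step true even-k otherEven d-even =
      nim-rotation-≡ 2 (s≤s (s≤s z≤n)) (λ d≡1 → contradiction d≡1 d≢1) (λ _ ())
        (rotation-values-∉ (vTwo-range true) refl) (below₂ half-option (reflection-option-d≢1 d≢1))
      where
      open RotationPosition {vRot = vTwo} ih span #Q even-k
      d≢1 : d ≢ 1
      d≢1 refl = case proj₁ (classify-otherEven d d-even) of λ ()
      half-option : OptionValue k Q 0
      half-option with even⇒half d (proj₁ (classify-otherEven d d-even))
      ... | h , d≡h+h = subst (λ c → OptionValue k Q (twoTable c true)) (classify-odd h-odd h≢1)
                              (subst (λ x → OptionValue k Q (vTwo x true)) gcd[h,d]≡h (small-rotation-option h 0<h h<d))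
        where
        0<h : 0 < h
        0<h = n≢0⇒n>0 λ { refl → d≢0 d≡h+h }
        h<d : h < d
        h<d = subst (h <_) (sym d≡h+h) (m<m+n h 0<h)
        h≢1 : h ≢ 1
        h≢1 refl = proj₂ (classify-otherEven d d-even) d≡h+h
        h-odd : even h ≡ false
        h-odd with even h in h-even
        ... | false = refl
        ... | true  = contradiction (∣-trans (even⇒2∣ {h} h-even) (double-∣-double (subst₂ _∣_ d≡h+h n≡m+m d∣n)))
                                    (odd⇒¬2∣ {m} m-odd)
        gcd[h,d]≡h : gcd h d ≡ h
        gcd[h,d]≡h = ∣-antisym (gcd[m,n]∣m h d)
                               (gcd-greatest ∣-refl (divides 2 (trans d≡h+h (cong (h +_) (sym (+-identityʳ h))))))
    step false even-k otherEven d-even =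
      nim-rotation-≡ 1 (s≤s z≤n) (λ d≡1 → contradiction d≡1 d≢1) (λ _ ())
        (rotation-values-∉ (vTwo-range false) refl)
        (below₁ (subst (λ x → OptionValue k Q (vTwo x false)) gcd[2,d]≡2
                       (small-rotation-option 2 (s≤s z≤n) (2<d d≢0 d≢1 (proj₂ (classify-otherEven d d-even))))))
      where
      open RotationPosition {vRot = vTwo} ih span #Q even-k
      d≢1 : d ≢ 1
      d≢1 refl = case proj₁ (classify-otherEven d d-even) of λ ()
      gcd[2,d]≡2 : gcd 2 d ≡ 2
      gcd[2,d]≡2 = ∣-antisym (gcd[m,n]∣m 2 d) (gcd-greatest ∣-refl (even⇒2∣ {d} (proj₁ (classify-otherEven d d-even))))

  nimGEN≡1 : 3 ≤ n → nimGEN n gen? ≡ 1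
  nimGEN≡1 3≤n = trans (nimGEN≡table {vTwo} two-step)
                       (cong (λ c → twoTable c true)
                             (classify-even 3≤n (subst (λ x → even x ≡ true) (sym n≡m+m) (even-double m))))

%2≡1⇒odd : ∀ n → n % 2 ≡ 1 → even n ≡ false
%2≡1⇒odd n n%2≡1 = begin
  even n                    ≡⟨ cong even (m≡m%n+[m/n]*n n 2) ⟩
  even (n % 2 + n / 2 * 2)  ≡⟨ cong (λ r → even (r + n / 2 * 2)) n%2≡1 ⟩
  not (even (n / 2 * 2))    ≡⟨ cong not (2∣⇒even (divides (n / 2) refl)) ⟩
  false                     ∎
  where open ≡-Reasoning

%4≡0⇒half-even : ∀ n → n % 4 ≡ 0 → ∃ λ m → n ≡ m + m × even m ≡ true
%4≡0⇒half-even n n%4≡0 = q * 2 , n≡2q+2q , 2∣⇒even (divides q refl)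
  where
  open ≡-Reasoning
  q = n / 4
  n≡2q+2q : n ≡ q * 2 + q * 2
  n≡2q+2q = begin
    n                  ≡⟨ m≡m%n+[m/n]*n n 4 ⟩
    n % 4 + q * 4      ≡⟨ cong (_+ q * 4) n%4≡0 ⟩
    q * 4              ≡⟨ *-distribˡ-+ q 2 2 ⟩
    q * 2 + q * 2      ∎

%4≡2⇒half-odd : ∀ n → n % 4 ≡ 2 → ∃ λ m → n ≡ m + m × even m ≡ false
%4≡2⇒half-odd n n%4≡2 = suc (q * 2) , n≡m+m , cong not (2∣⇒even (divides q refl))
  where
  open ≡-Reasoning
  q = n / 4
  n≡m+m : n ≡ suc (q * 2) + suc (q * 2)
  n≡m+m = begin
    n                            ≡⟨ m≡m%n+[m/n]*n n 4 ⟩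
    n % 4 + q * 4                ≡⟨ cong (_+ q * 4) n%4≡2 ⟩
    suc (suc (q * 4))            ≡⟨ cong (suc ∘ suc) (*-distribˡ-+ q 2 2) ⟩
    suc (suc (q * 2 + q * 2))    ≡⟨ cong suc (+-suc (q * 2) (q * 2)) ⟨
    suc (q * 2) + suc (q * 2)    ∎

corollary7p10 : (n : ℕ) .{{_ : NonZero n}} → 3 ≤ n →
    (gen? : (P : SubsetD n) → Dec (Generates n P)) →
      (n % 2 ≡ 1 → nimGEN n gen? ≡ 3)
      × (n % 4 ≡ 0 → nimGEN n gen? ≡ 0)
      × (n % 4 ≡ 2 → nimGEN n gen? ≡ 1)
corollary7p10 n 3≤n gen? =
    (λ n%2≡1 → OddOrder.nimGEN≡3 n {{n-nonZero}} gen? (%2≡1⇒odd n n%2≡1) n≢1)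
  , (λ n%4≡0 → let m , n≡m+m , m-even = %4≡0⇒half-even n n%4≡0 in
               DoublyEvenOrder.nimGEN≡0 n {{n-nonZero}} gen? m n≡m+m m-even n≢1)
  , (λ n%4≡2 → let m , n≡m+m , m-odd = %4≡2⇒half-odd n n%4≡2 in
               SinglyEvenOrder.nimGEN≡1 n {{n-nonZero}} gen? m n≡m+m m-odd 3≤n)
  where
  n-nonZero : NonZero n
  n-nonZero = >-nonZero (<-≤-trans z<s 3≤n)
  n≢1 : n ≢ 1
  n≢1 refl = case 3≤n of λ { (s≤s ()) }
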